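{- There exist absolute constants $c\in(0,1)$ and $K>0$ such that the following holds. For every integer $N\ge 1$ and every even integer $n\ge N$, there exists a 1--3 tree on $n$ vertices in which the number of distinct lengths of leaf-to-leaf paths lying in $\{0,1,\dots,N\}$ is at most $K N^{c}$.
   Context: A 1--3 tree is a tree in which every vertex has degree $1$ or $3$. A leaf is a vertex of degree $1$; a leaf-to-leaf path is a path whose endpoints are both leaves, its length is its number of edges, and a single vertex is considered a path of length $0$. -}

module Defs where

open import Data.Nat using (ℕ; zero; suc; _+_; _≤_)
open import Data.Fin using (Fin)
open import Data.Bool using (Bool; true; false; if_then_else_)
open import Data.List using (List; []; _∷_; length; map; allFin)
open import Data.Nat.ListAction using (sum)
open import Data.List.Relation.Unary.Linked using (Linked)
open import Data.List.Relation.Unary.Unique.Propositional using (Unique)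
open import Data.List.Membership.Propositional using (_∈_)
open import Data.Product using (Σ; _×_; ∃; ∃-syntax; _,_)
open import Data.Sum using (_⊎_)
open import Relation.Binary.PropositionalEquality using (_≡_)
open import Relation.Nullary using (¬_)

record Graph (n : ℕ) : Set where
  field
    adj   : Fin n → Fin n → Bool
    sym   : ∀ i j → adj i j ≡ adj j i
    irrefl : ∀ i → adj i i ≡ false
open Graph public

Adj : ∀ {n} → Graph n → Fin n → Fin n → Set
Adj G i j = adj G i j ≡ true

degree : ∀ {n} → Graph n → Fin n → ℕ
degree {n} G i = sum (map (λ j → if adj G i j then 1 else 0) (allFin n))

lastOf : ∀ {A : Set} → A → List A → A
lastOf x []       = x
lastOf x (y ∷ ys) = lastOf y ys

-- A path is a nonempty list of pairwise distinct vertices, consecutive ones adjacent.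
-- The list u ∷ rest has length (length rest) as a path; a single vertex is a path of length 0.
IsPath : ∀ {n} → Graph n → Fin n → List (Fin n) → Set
IsPath G u rest = Unique (u ∷ rest) × Linked (Adj G) (u ∷ rest)

PathBetween : ∀ {n} → Graph n → Fin n → Fin n → Set
PathBetween G u v = ∃[ rest ] (IsPath G u rest × lastOf u rest ≡ v)

IsCycle : ∀ {n} → Graph n → Fin n → List (Fin n) → Set
IsCycle G u rest = IsPath G u rest × 2 ≤ length rest × Adj G (lastOf u rest) u

Connected : ∀ {n} → Graph n → Set
Connected G = ∀ u v → PathBetween G u v

Acyclic : ∀ {n} → Graph n → Set
Acyclic G = ∀ u rest → ¬ IsCycle G u rest

IsTree : ∀ {n} → Graph n → Set
IsTree G = Connected G × Acyclic G

IsLeaf : ∀ {n} → Graph n → Fin n → Set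
IsLeaf G v = degree G v ≡ 1

Is13Tree : ∀ {n} → Graph n → Set
Is13Tree G = IsTree G × (∀ v → degree G v ≡ 1 ⊎ degree G v ≡ 3)

LeafPathLength : ∀ {n} → Graph n → ℕ → Set
LeafPathLength G ℓ =
  ∃[ u ] ∃[ rest ] (IsPath G u rest × IsLeaf G u × IsLeaf G (lastOf u rest) × length rest ≡ ℓ)

-- The tree is planted: an extra leaf, the stem, hangs below the root of a binary tree, so
-- every degree is 1 or 3 and the tree has twice as many vertices as the binary tree has
-- leaves. The binary tree is a comb: spine node i carries a perfect tree of depth h(i), and
-- an almost perfect tree holding the remaining leaves closes the spine. Two leaves are then
-- at distance at most 2·max h, or their distance is read off the spine: (j − i) + h(i) + h(j) + 2
-- for pendant trees i < j, i + h(i) + 2 from the stem, and similarly for the closing tree.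
-- Let 8^d ≤ N < 8^(d+1) and s = 7^d. Writing i = ρ + κs with ρ < s, choose h(i) = P(2ρ) + ρ,
-- where P replaces each base-7 digit r by p(r) ∈ {0,1,3} with p(r) + r ∈ {3,4,6}. Every such
-- distance is then a multiple of s plus a numeral with all base-7 digits in {0,1,3}, in {3,4,6}
-- or in their sumset {3,4,5,6,7,9}, so only (N/s + 1)·O(6^d) + O(s) = O(7^d) distances are
-- at most N, and 7^16 ≤ 8^15 turns O(7^d) into O(N^(15/16)).

module Submission where

open import Defs hiding (sym)
open import Data.Nat using (ℕ; _≤_; _<_; _^_; _*_)
open import Data.Nat.Divisibility using (_∣_)
open import Data.List using (List; length)
open import Data.List.Membership.Propositional using (_∈_)
open import Data.Product using (_×_; ∃-syntax)

open import Data.Bool using (Bool; true; false; if_then_else_)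
open import Data.Bool.Properties using () renaming (_≟_ to _≟ᵇ_)
open import Data.Empty using (⊥-elim)
open import Data.Fin as Fin using (Fin; _↑ˡ_; _↑ʳ_; splitAt)
open import Data.Fin.Properties using (splitAt-↑ˡ; splitAt-↑ʳ; splitAt⁻¹-↑ˡ; splitAt⁻¹-↑ʳ)
open import Data.List using ([]; _∷_; map; _++_; filter; allFin; upTo; cartesianProductWith)
open import Data.List.Properties using (length-map; length-++; length-upTo)
open import Data.List.Membership.Propositional.Properties
  using (∈-filter⁺; ∈-filter⁻; ∈-allFin; ∈-map⁺; ∈-map⁻; ∈-++⁺ˡ; ∈-++⁺ʳ; ∈-upTo⁺;
         ∈-cartesianProductWith⁺; ∈-cartesianProductWith⁻)
open import Data.List.Membership.Propositional.Properties.WithK using (unique∧set⇒bag)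
open import Data.List.Relation.Binary.BagAndSetEquality using (∼bag⇒↭)
open import Data.List.Relation.Binary.Permutation.Propositional.Properties using (↭-length)
open import Data.List.Relation.Unary.All as All using (All; []; _∷_; all?)
open import Data.List.Relation.Unary.All.Properties using (¬Any⇒All¬)
open import Data.List.Relation.Unary.Any using (here; there)
open import Data.List.Relation.Unary.Linked as Linked using (Linked; []; [-]; _∷_)
import Data.List.Relation.Unary.Linked.Properties as Linkedₚ
open import Data.List.Relation.Unary.Unique.Propositional using (Unique; []; _∷_)
import Data.List.Relation.Unary.Unique.Propositional.Properties as Uniqueₚ
open import Data.List.Relation.Unary.Unique.Propositional.Properties using (allFin⁺; filter⁺)
open import Data.Maybe using (Maybe; just; nothing)
open import Data.Nat using (zero; suc; _+_; _∸_; _⊔_; _/_; _%_; s≤s; z≤n; _≤?_; NonZero)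
open import Data.Nat.DivMod using (m≡m%n+[m/n]*n; m%n<n; m<n*o⇒m/o<n; m*n/n≡m; /-monoˡ-≤; m/n*n≤m)
open import Data.Nat.Divisibility using (divides)
open import Data.Nat.GeneralisedArithmetic using (fold; iterate; iterate-is-fold)
open import Data.Nat.ListAction using (sum)
open import Data.Nat.Properties hiding (_≟_)
open import Data.Nat.Tactic.RingSolver using (solve-∀)
open import Data.Product using (Σ; ∃; _,_; proj₁; proj₂)
open import Data.Sum as Sum using (_⊎_; inj₁; inj₂)
open import Data.Unit using (⊤; tt)
open import Function using (_∘_)
open import Function.Bundles using (_⇔_; mk⇔; Equivalence; _↔_; mk↔ₛ′; Inverse)
open import Relation.Binary using (DecidableEquality)
open import Relation.Binary.Construct.Closure.ReflexiveTransitive using (Star; ε; _◅_; _◅◅_)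
  renaming (reverse to reverseStar)
open import Relation.Binary.PropositionalEquality
open import Relation.Nullary using (¬_; Dec; yes; no; does; ¬?)
open import Relation.Nullary.Decidable using (map′; _×-dec_; _⊎-dec_; dec-true; dec-false; does-⇔; from-yes)

-- Degrees and paths in finite graphs

sum-indicator≡length-filter : ∀ {A : Set} (f : A → Bool) (xs : List A) →
  sum (map (λ x → if f x then 1 else 0) xs) ≡ length (filter (λ x → f x ≟ᵇ true) xs)
sum-indicator≡length-filter f [] = refl
sum-indicator≡length-filter f (x ∷ xs) with f x
... | true  = cong suc (sum-indicator≡length-filter f xs)
... | false = sum-indicator≡length-filter f xs

degree≡length : ∀ {n} (G : Graph n) i {xs : List (Fin n)} → Unique xs →
                (∀ {j} → j ∈ xs ⇔ Adj G i j) → degree G i ≡ length xs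
degree≡length {n} G i {xs} xs! xs⇔adj = trans (sum-indicator≡length-filter (adj G i) (allFin n))
  (↭-length (∼bag⇒↭ (unique∧set⇒bag (filter⁺ adj? {allFin n} (allFin⁺ n)) xs! (mk⇔
    (λ j∈ → Equivalence.from xs⇔adj (proj₂ (∈-filter⁻ adj? {xs = allFin n} j∈)))
    (λ j∈ → ∈-filter⁺ adj? (∈-allFin _) (Equivalence.to xs⇔adj j∈))))))
  where adj? = λ j → adj G i j ≟ᵇ true

module _ {n : ℕ} (G : Graph n) where
  open import Data.List.Membership.DecPropositional (Fin._≟_ {n}) using (_∈?_)

  Walk : Fin n → Fin n → Set
  Walk = Star (Adj G)

  reverseWalk : ∀ {u v} → Walk u v → Walk v u
  reverseWalk = reverseStar (λ {i} {j} e → trans (Graph.sym G j i) e)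

  suffix-path : ∀ {u x rest v} → u ∈ x ∷ rest → IsPath G x rest → lastOf x rest ≡ v →
                PathBetween G u v
  suffix-path (here refl) path last = _ , path , last
  suffix-path {rest = _ ∷ _} (there u∈) (_ ∷ distinct , _ ∷ linked) last =
    suffix-path u∈ (distinct , linked) last

  walk⇒path : ∀ {u v} → Walk u v → PathBetween G u v
  walk⇒path ε = [] , ([] ∷ [] , [-]) , refl
  walk⇒path {u} (e ◅ walk) with walk⇒path walk
  ... | rest , (distinct , linked) , last with u ∈? (_ ∷ rest)
  ...   | yes u∈ = suffix-path u∈ (distinct , linked) last
  ...   | no u∉  = _ ∷ rest , (¬Any⇒All¬ _ u∉ ∷ distinct , e ∷ linked) , last

lastOf-map : ∀ {A B : Set} (f : A → B) x xs → lastOf (f x) (map f xs) ≡ f (lastOf x xs)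
lastOf-map f x []       = refl
lastOf-map f x (y ∷ ys) = lastOf-map f y ys

lastOf-∈ : ∀ {A : Set} (x : A) xs → lastOf x xs ∈ x ∷ xs
lastOf-∈ x []       = here refl
lastOf-∈ x (y ∷ ys) = there (lastOf-∈ y ys)

-- Rooted trees

record RootedTree (V : Set) : Set where
  field
    root            : V
    parent          : V → V          -- junk at the root
    depth           : V → ℕ
    depth-parent    : ∀ {v} → v ≢ root → depth v ≡ suc (depth (parent v))
    children        : V → List V
    children-unique : ∀ v → Unique (children v)
    ∈-children      : ∀ {u v} → v ∈ children u ⇔ (v ≢ root × parent v ≡ u)

module RootedTreeProperties {V : Set} (T : RootedTree V) where
  open RootedTree T

  Child : V → V → Set
  Child u v = v ≢ root × parent v ≡ u

  Edge : V → V → Set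
  Edge u v = Child u v ⊎ Child v u

  depth-child : ∀ {u v} → Child u v → depth v ≡ suc (depth u)
  depth-child (v≢root , refl) = depth-parent v≢root

  child-irrefl : ∀ {v} → ¬ Child v v
  child-irrefl c = 1+n≢n (sym (depth-child c))

  child-asym : ∀ {u v} → Child u v → ¬ Child v u
  child-asym c c′ = m≢1+n+m _ (trans (depth-child c) (cong suc (depth-child c′)))

  ¬Child-root : ∀ {v} → ¬ Child v root
  ¬Child-root (root≢root , _) = root≢root refl

  neighbours-root : ∀ {w} → w ∈ children root ⇔ Edge root w
  neighbours-root = mk⇔ (inj₁ ∘ Equivalence.to ∈-children)
    λ { (inj₁ c) → Equivalence.from ∈-children c ; (inj₂ c) → ⊥-elim (¬Child-root c) }

  neighbours-nonroot : ∀ {v} → v ≢ root →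
    Unique (parent v ∷ children v) × (∀ {w} → w ∈ parent v ∷ children v ⇔ Edge v w)
  neighbours-nonroot {v} v≢root =
      ¬Any⇒All¬ _ (λ p∈ → child-asym (v≢root , refl) (Equivalence.to ∈-children p∈))
        ∷ children-unique v
    , mk⇔ (λ { (here refl) → inj₂ (v≢root , refl) ; (there w∈) → inj₁ (Equivalence.to ∈-children w∈) })
          (λ { (inj₁ c) → there (Equivalence.from ∈-children c) ; (inj₂ (_ , refl)) → here refl })

  -- Recursive rather than inductive, so that firstChild (d ∷ʳ c) reduces to firstChild d.
  Descendant : ℕ → V → V → Set
  Descendant zero    u v = u ≡ v
  Descendant (suc a) u v = Σ V λ w → Child u w × Descendant a w v

  firstChild : ∀ {a u v} → Descendant (suc a) u v → V
  firstChild = proj₁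

  _∷ʳ_ : ∀ {a u v w} → Descendant a u v → Child v w → Descendant (suc a) u w
  _∷ʳ_ {zero}  refl           c = _ , c , refl
  _∷ʳ_ {suc a} (w , c′ , d)   c = w , c′ , d ∷ʳ c

  depth-descendant : ∀ {a u v} → Descendant a u v → depth v ≡ a + depth u
  depth-descendant {zero}  refl        = refl
  depth-descendant {suc a} (_ , c , d) =
    trans (depth-descendant d) (trans (cong (a +_) (depth-child c)) (+-suc a _))

  descendant⇒ancestor : ∀ {a u v} → Descendant a u v → u ≡ fold v parent a
  descendant⇒ancestor {zero}  refl                 = refl
  descendant⇒ancestor {suc a} (_ , (_ , refl) , d) = cong parent (descendant⇒ancestor d)

  firstChild-ancestor : ∀ {a u v} (d : Descendant (suc a) u v) → firstChild d ≡ fold v parent a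
  firstChild-ancestor (_ , _ , d) = descendant⇒ancestor d

  descendant-nonroot : ∀ {a u v} → Descendant (suc a) u v → v ≢ root
  descendant-nonroot {zero}  (_ , (w≢root , _) , refl) = w≢root
  descendant-nonroot {suc a} (_ , _ , d)               = descendant-nonroot d

  Forked : ∀ {a b t u w} → Descendant a t u → Descendant b t w → Set
  Forked {suc a} {suc b} d d′ = firstChild d ≢ firstChild d′
  Forked {zero}          _ _  = ⊤
  Forked {suc a} {zero}  _ _  = ⊤

  FirstStep : ∀ {a b t u w} → List V → Descendant a t u → Descendant b t w → Set
  FirstStep                   []      _ _ = ⊤
  FirstStep {suc a} {u = u}   (v ∷ _) _ _ = Child v u
  FirstStep {zero}  {suc b}   (v ∷ _) _ d = firstChild d ≡ v
  FirstStep {zero}  {zero}    (v ∷ _) _ _ = ⊤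

  -- The path u ∷ rest climbs from u to top and then descends; its two branches leave top
  -- through different children, and first-step determines its second vertex.
  record Profile (u : V) (rest : List V) : Set where
    constructor mkProfile
    field
      top        : V
      up down    : ℕ
      length≡    : up + down ≡ length rest
      climb      : Descendant up top u
      descent    : Descendant down top (lastOf u rest)
      forked     : Forked climb descent
      first-step : FirstStep rest climb descent

  profile-up : ∀ {u v rest} → All (u ≢_) (v ∷ rest) → Child v u → Profile v rest → Profile u (v ∷ rest)
  profile-up _ c (mkProfile t (suc a) b len climb descent forked _) =
    mkProfile t (suc (suc a)) b (cong suc len) (climb ∷ʳ c) descent (forked′ b descent forked) c
    where
    forked′ : ∀ b (descent : Descendant b t _) → Forked climb descent → Forked (climb ∷ʳ c) descent
    forked′ zero    _ _ = tt
    forked′ (suc b) _ f = f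
  profile-up _ c (mkProfile t zero zero len refl descent _ _) =
    mkProfile t 1 zero (cong suc len) (_ , c , refl) descent tt c
  profile-up (_ ∷ u≢x ∷ _) c (mkProfile t zero (suc b) len refl descent _ refl) =
    mkProfile t 1 (suc b) (cong suc len) (_ , c , refl) descent u≢x c

  profile-down : ∀ {u v rest} → All (u ≢_) (v ∷ rest) → Child u v → Profile v rest → Profile u (v ∷ rest)
  profile-down _ c (mkProfile _ zero b len refl descent _ _) =
    mkProfile _ zero (suc b) (cong suc len) refl (_ , c , descent) tt refl
  profile-down (_ ∷ u≢x ∷ _) (_ , refl) (mkProfile _ (suc a) _ _ _ _ _ (_ , refl)) = ⊥-elim (u≢x refl)

  profile : ∀ {u rest} → Unique (u ∷ rest) → Linked Edge (u ∷ rest) → Profile u rest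
  profile {u} {[]}  _                _                  = mkProfile u 0 0 refl refl refl tt tt
  profile {rest = _ ∷ _} (u∉ ∷ distinct) (inj₁ c ∷ linked) = profile-down u∉ c (profile distinct linked)
  profile {rest = _ ∷ _} (u∉ ∷ distinct) (inj₂ c ∷ linked) = profile-up u∉ c (profile distinct linked)

  -- The closing edge makes up and down differ by one, so either the second vertex of the path
  -- would be its last one, or both branches would leave top through the same child.
  no-closing-edge : ∀ {u v x rest} → Unique (u ∷ v ∷ x ∷ rest) → Linked Edge (u ∷ v ∷ x ∷ rest) →
                    ¬ Edge (lastOf x rest) u
  no-closing-edge {u} {v} {x} {rest} distinct@(_ ∷ v∉ ∷ _) linked closing with profile distinct linked
  ... | mkProfile t a b _ climb descent forked first-step = go a b climb descent forked first-step closing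
    where
    w = lastOf x rest

    v≢w : v ≢ w
    v≢w = All.lookup v∉ (lastOf-∈ x rest)

    go : ∀ a b (climb : Descendant a t u) (descent : Descendant b t w) →
         Forked climb descent → FirstStep (v ∷ x ∷ rest) climb descent → ¬ Edge w u
    go a b climb descent forked first-step (inj₁ c)
      with +-cancelʳ-≡ (depth t) a (suc b)
             (trans (sym (depth-descendant climb)) (trans (depth-child c) (cong suc (depth-descendant descent))))
    ... | refl = v≢w (trans (sym (proj₂ first-step)) (proj₂ c))
    go a b climb descent forked first-step (inj₂ c)
      with +-cancelʳ-≡ (depth t) b (suc a)
             (trans (sym (depth-descendant descent)) (trans (depth-child c) (cong suc (depth-descendant climb))))
    go zero    _ refl (_ , _ , refl) forked first-step (inj₂ c) | refl = v≢w (sym first-step)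
    go (suc a) _ climb descent       forked first-step (inj₂ c) | refl =
      forked (begin
        firstChild climb              ≡⟨ firstChild-ancestor climb ⟩
        fold u parent a               ≡⟨ cong (λ y → fold y parent a) (sym (proj₂ c)) ⟩
        fold (parent w) parent a      ≡⟨ iterate-is-fold (parent w) parent a ⟩
        iterate parent w (suc a)      ≡⟨ sym (iterate-is-fold w parent (suc a)) ⟩
        fold w parent (suc a)         ≡⟨ sym (firstChild-ancestor descent) ⟩
        firstChild descent            ∎)
      where open ≡-Reasoning

module TreeGraph {n : ℕ} {V : Set} (enum : Fin n ↔ V) (T : RootedTree V) where
  open Inverse enum using (to; from; strictlyInverseˡ; strictlyInverseʳ)
  open RootedTree T
  open RootedTreeProperties T

  to-injective : ∀ {i j} → to i ≡ to j → i ≡ j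
  to-injective {i} {j} e = trans (sym (strictlyInverseʳ i)) (trans (cong from e) (strictlyInverseʳ j))

  from-injective : ∀ {x y} → from x ≡ from y → x ≡ y
  from-injective {x} {y} e = trans (sym (strictlyInverseˡ x)) (trans (cong to e) (strictlyInverseˡ y))

  _≟_ : DecidableEquality V
  x ≟ y = map′ from-injective (cong from) (from x Fin.≟ from y)

  child? : ∀ u v → Dec (Child u v)
  child? u v = ¬? (v ≟ root) ×-dec (parent v ≟ u)

  edge? : ∀ u v → Dec (Edge u v)
  edge? u v = child? u v ⊎-dec child? v u

  graph : Graph n
  graph = record
    { adj    = λ i j → does (edge? (to i) (to j))
    ; sym    = λ i j → does-⇔ (mk⇔ Sum.swap Sum.swap) (edge? (to i) (to j)) (edge? (to j) (to i))
    ; irrefl = λ i → dec-false (edge? (to i) (to i)) Sum.[ child-irrefl , child-irrefl ]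
    }

  adj⇔edge : ∀ {i j} → Adj graph i j ⇔ Edge (to i) (to j)
  adj⇔edge {i} {j} = mk⇔ (true⇒ (edge? (to i) (to j))) (dec-true (edge? (to i) (to j)))
    where
    true⇒ : ∀ {A : Set} (a? : Dec A) → does a? ≡ true → A
    true⇒ (yes a) _ = a

  path-in-tree : ∀ {u rest} → IsPath graph u rest →
                 Unique (to u ∷ map to rest) × Linked Edge (to u ∷ map to rest)
  path-in-tree (distinct , linked) =
    Uniqueₚ.map⁺ to-injective distinct , Linkedₚ.map⁺ (Linked.map (Equivalence.to adj⇔edge) linked)

  path-profile : ∀ {u rest} → IsPath graph u rest → Profile (to u) (map to rest)
  path-profile path = profile (proj₁ (path-in-tree path)) (proj₂ (path-in-tree path))

  acyclic : Acyclic graph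
  acyclic u []            (_ , () , _)
  acyclic u (_ ∷ [])      (_ , s≤s () , _)
  acyclic u (v ∷ x ∷ rest) (path , _ , closing) =
    no-closing-edge (proj₁ (path-in-tree path)) (proj₂ (path-in-tree path))
      (subst (λ y → Edge y (to u)) (sym (lastOf-map to x rest)) (Equivalence.to adj⇔edge closing))

  walk-to-root : ∀ k i → depth (to i) ≡ k → Walk graph i (from root)
  walk-to-root k i d with to i ≟ root
  ... | yes i↦root =
    subst (λ j → Walk graph j (from root)) (trans (cong from (sym i↦root)) (strictlyInverseʳ i)) ε
  walk-to-root zero    i d | no i↦nonroot with () ← trans (sym (depth-parent i↦nonroot)) d
  walk-to-root (suc k) i d | no i↦nonroot =
    Equivalence.from adj⇔edge (inj₂ (i↦nonroot , sym (strictlyInverseˡ _)))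
      ◅ walk-to-root k (from (parent (to i)))
          (trans (cong depth (strictlyInverseˡ _)) (suc-injective (trans (sym (depth-parent i↦nonroot)) d)))

  connected : Connected graph
  connected i j = walk⇒path graph (walk-to-root _ i refl ◅◅ reverseWalk graph (walk-to-root _ j refl))

  is-tree : IsTree graph
  is-tree = connected , acyclic

  degree-via-neighbours : ∀ i {xs} → Unique xs → (∀ {y} → y ∈ xs ⇔ Edge (to i) y) →
                          degree graph i ≡ length xs
  degree-via-neighbours i {xs} xs! xs⇔edge =
    trans (degree≡length graph i (Uniqueₚ.map⁺ from-injective xs!) (mk⇔ ∈⇒adj adj⇒∈)) (length-map from xs)
    where
    ∈⇒adj : ∀ {j} → j ∈ map from xs → Adj graph i j
    ∈⇒adj j∈ with ∈-map⁻ from j∈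
    ... | y , y∈ , refl = Equivalence.from adj⇔edge
                            (subst (Edge (to i)) (sym (strictlyInverseˡ y)) (Equivalence.to xs⇔edge y∈))
    adj⇒∈ : ∀ {j} → Adj graph i j → j ∈ map from xs
    adj⇒∈ {j} a = subst (_∈ map from xs) (strictlyInverseʳ j)
                    (∈-map⁺ from (Equivalence.from xs⇔edge (Equivalence.to adj⇔edge a)))

  degree-root : ∀ i → to i ≡ root → degree graph i ≡ length (children root)
  degree-root i refl = degree-via-neighbours i (children-unique root) neighbours-root

  degree-nonroot : ∀ i → to i ≢ root → degree graph i ≡ suc (length (children (to i)))
  degree-nonroot i i↦nonroot =
    degree-via-neighbours i (proj₁ (neighbours-nonroot i↦nonroot)) (proj₂ (neighbours-nonroot i↦nonroot))

-- Planted binary trees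

data Bin : Set where
  leaf : Bin
  node : Bin → Bin → Bin

size : Bin → ℕ
size leaf       = 1
size (node l r) = suc (size l + size r)

leaves : Bin → ℕ
leaves leaf       = 1
leaves (node l r) = leaves l + leaves r

1+size≡leaves*2 : ∀ t → suc (size t) ≡ leaves t * 2
1+size≡leaves*2 leaf       = refl
1+size≡leaves*2 (node l r) = trans (cong suc (sym (+-suc (size l) (size r))))
  (trans (cong₂ _+_ (1+size≡leaves*2 l) (1+size≡leaves*2 r)) (sym (*-distribʳ-+ 2 (leaves l) (leaves r))))

data LeafDepth : Bin → ℕ → Set where
  here  : LeafDepth leaf 0
  left  : ∀ {l r a} → LeafDepth l a → LeafDepth (node l r) (suc a)
  right : ∀ {l r a} → LeafDepth r a → LeafDepth (node l r) (suc a)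

data LeafDistance : Bin → ℕ → Set where
  across : ∀ {l r a b} → LeafDepth l a → LeafDepth r b → LeafDistance (node l r) (suc (suc (a + b)))
  left   : ∀ {l r c} → LeafDistance l c → LeafDistance (node l r) c
  right  : ∀ {l r c} → LeafDistance r c → LeafDistance (node l r) c

data Pos : Bin → Set where
  here  : ∀ {t} → Pos t
  left  : ∀ {l r} → Pos l → Pos (node l r)
  right : ∀ {l r} → Pos r → Pos (node l r)

subtree : ∀ {t} → Pos t → Bin
subtree {t} here  = t
subtree (left p)  = subtree p
subtree (right p) = subtree p

intoLeft : ∀ {l r} → Maybe (Pos l) → Pos (node l r)
intoLeft nothing  = here
intoLeft (just p) = left p

intoRight : ∀ {l r} → Maybe (Pos r) → Pos (node l r)
intoRight nothing  = here
intoRight (just p) = right p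

parentPos : ∀ {t} → Pos t → Maybe (Pos t)
parentPos here      = nothing
parentPos (left p)  = just (intoLeft (parentPos p))
parentPos (right p) = just (intoRight (parentPos p))

childPositions : ∀ {t} → Pos t → List (Pos t)
childPositions {leaf}     here = []
childPositions {node l r} here = left here ∷ right here ∷ []
childPositions (left p)        = map left (childPositions p)
childPositions (right p)       = map right (childPositions p)

depthPos : ∀ {t} → Pos t → ℕ
depthPos here      = 0
depthPos (left p)  = suc (depthPos p)
depthPos (right p) = suc (depthPos p)

arity : Bin → ℕ
arity leaf       = 0
arity (node _ _) = 2

length-childPositions : ∀ {t} (p : Pos t) → length (childPositions p) ≡ arity (subtree p)
length-childPositions {leaf}     here      = refl
length-childPositions {node l r} here      = refl
length-childPositions            (left p)  = trans (length-map left (childPositions p)) (length-childPositions p)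
length-childPositions            (right p) = trans (length-map right (childPositions p)) (length-childPositions p)

childPositions-tip : ∀ {t} (p : Pos t) → subtree p ≡ leaf → childPositions p ≡ []
childPositions-tip {leaf} here      _   = refl
childPositions-tip        (left p)  tip = cong (map left) (childPositions-tip p tip)
childPositions-tip        (right p) tip = cong (map right) (childPositions-tip p tip)

childPositions-unique : ∀ {t} (p : Pos t) → Unique (childPositions p)
childPositions-unique {leaf}     here      = []
childPositions-unique {node l r} here      = ((λ ()) ∷ []) ∷ [] ∷ []
childPositions-unique            (left p)  = Uniqueₚ.map⁺ (λ { refl → refl }) (childPositions-unique p)
childPositions-unique            (right p) = Uniqueₚ.map⁺ (λ { refl → refl }) (childPositions-unique p)

parentPos-root : ∀ {t} {p : Pos t} → parentPos p ≡ nothing → p ≡ here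
parentPos-root {p = here} _ = refl

∈-childPositions : ∀ {t} {p q : Pos t} → q ∈ childPositions p ⇔ parentPos q ≡ just p
∈-childPositions = mk⇔ (child⇒ _) (child⇐ _)
  where
  child⇒ : ∀ {t} (p : Pos t) {q} → q ∈ childPositions p → parentPos q ≡ just p
  child⇒ {node l r} here (here refl)         = refl
  child⇒ {node l r} here (there (here refl)) = refl
  child⇒ (left p)  q∈ with ∈-map⁻ left q∈
  ... | q , q∈′ , refl = cong (λ m → just (intoLeft m)) (child⇒ p q∈′)
  child⇒ (right p) q∈ with ∈-map⁻ right q∈
  ... | q , q∈′ , refl = cong (λ m → just (intoRight m)) (child⇒ p q∈′)
  child⇐ : ∀ {t} (q : Pos t) {p} → parentPos q ≡ just p → q ∈ childPositions p
  child⇐ (left q)  eq with parentPos q in eq′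
  child⇐ (left q)  refl | nothing rewrite parentPos-root eq′ = here refl
  child⇐ (left q)  refl | just p  = ∈-map⁺ left (child⇐ q eq′)
  child⇐ (right q) eq with parentPos q in eq′
  child⇐ (right q) refl | nothing rewrite parentPos-root eq′ = there (here refl)
  child⇐ (right q) refl | just p  = ∈-map⁺ right (child⇐ q eq′)

-- nothing is the stem, an extra leaf attached to the root.
Vertex : Bin → Set
Vertex t = Maybe (Pos t)

vertexDepth : ∀ {t} → Vertex t → ℕ
vertexDepth nothing  = 0
vertexDepth (just p) = suc (depthPos p)

vertexParent : ∀ {t} → Vertex t → Vertex t
vertexParent nothing  = nothing
vertexParent (just p) = parentPos p

vertexChildren : ∀ {t} → Vertex t → List (Vertex t)
vertexChildren nothing  = just here ∷ []
vertexChildren (just p) = map just (childPositions p)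

depthPos-parentPos : ∀ {t} (p : Pos t) → depthPos p ≡ vertexDepth (parentPos p)
depthPos-parentPos here      = refl
depthPos-parentPos (left p)  with parentPos p | depthPos-parentPos p
... | nothing | eq = cong suc eq
... | just _  | eq = cong suc eq
depthPos-parentPos (right p) with parentPos p | depthPos-parentPos p
... | nothing | eq = cong suc eq
... | just _  | eq = cong suc eq

∈-vertexChildren : ∀ {t} {u v : Vertex t} → v ∈ vertexChildren u ⇔ (v ≢ nothing × vertexParent v ≡ u)
∈-vertexChildren = mk⇔ (child⇒ _) (child⇐ _ _)
  where
  child⇒ : ∀ {t} (u : Vertex t) {v} → v ∈ vertexChildren u → v ≢ nothing × vertexParent v ≡ u
  child⇒ nothing  (here refl) = (λ ()) , refl
  child⇒ (just p) v∈ with ∈-map⁻ just v∈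
  ... | q , q∈ , refl = (λ ()) , Equivalence.to ∈-childPositions q∈
  child⇐ : ∀ {t} (u v : Vertex t) → v ≢ nothing × vertexParent v ≡ u → v ∈ vertexChildren u
  child⇐ _        nothing  (v≢nothing , _)  = ⊥-elim (v≢nothing refl)
  child⇐ nothing  (just q) (_ , eq) rewrite parentPos-root eq = here refl
  child⇐ (just p) (just q) (_ , eq) = ∈-map⁺ just (Equivalence.from ∈-childPositions eq)

plantedTree : (t : Bin) → RootedTree (Vertex t)
plantedTree t = record
  { root            = nothing
  ; parent          = vertexParent
  ; depth           = vertexDepth
  ; depth-parent    = λ { {nothing} v≢nothing → ⊥-elim (v≢nothing refl)
                        ; {just p}  _         → cong suc (depthPos-parentPos p) }
  ; children        = vertexChildren
  ; children-unique = λ { nothing  → [] ∷ []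
                        ; (just p) → Uniqueₚ.map⁺ (λ { refl → refl }) (childPositions-unique p) }
  ; ∈-children      = ∈-vertexChildren
  }

index : ∀ {t} → Pos t → Fin (size t)
index {leaf}     here      = Fin.zero
index {node l r} here      = Fin.zero
index {node l r} (left p)  = Fin.suc (index p ↑ˡ size r)
index {node l r} (right p) = Fin.suc (size l ↑ʳ index p)

position : ∀ {t} → Fin (size t) → Pos t
position {leaf}     Fin.zero    = here
position {node l r} Fin.zero    = here
position {node l r} (Fin.suc i) with splitAt (size l) i
... | inj₁ j = left (position j)
... | inj₂ j = right (position j)

position-index : ∀ {t} (p : Pos t) → position (index p) ≡ p
position-index {leaf}     here      = refl
position-index {node l r} here      = refl
position-index {node l r} (left p)  rewrite splitAt-↑ˡ (size l) (index p) (size r) = cong left (position-index p)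
position-index {node l r} (right p) rewrite splitAt-↑ʳ (size l) (size r) (index p) = cong right (position-index p)

index-position : ∀ {t} (i : Fin (size t)) → index (position {t} i) ≡ i
index-position {leaf}     Fin.zero    = refl
index-position {node l r} Fin.zero    = refl
index-position {node l r} (Fin.suc i) with splitAt (size l) i in eq
... | inj₁ j = cong Fin.suc (trans (cong (_↑ˡ size r) (index-position j)) (splitAt⁻¹-↑ˡ eq))
... | inj₂ j = cong Fin.suc (trans (cong (size l ↑ʳ_) (index-position j)) (splitAt⁻¹-↑ʳ eq))

vertices : ∀ t → Fin (suc (size t)) ↔ Vertex t
vertices t = mk↔ₛ′ vertex vertexIndex vertex-vertexIndex vertexIndex-vertex
  where
  vertex : Fin (suc (size t)) → Vertex t
  vertex Fin.zero    = nothing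
  vertex (Fin.suc i) = just (position i)
  vertexIndex : Vertex t → Fin (suc (size t))
  vertexIndex nothing  = Fin.zero
  vertexIndex (just p) = Fin.suc (index p)
  vertex-vertexIndex : ∀ v → vertex (vertexIndex v) ≡ v
  vertex-vertexIndex nothing  = refl
  vertex-vertexIndex (just p) = cong just (position-index p)
  vertexIndex-vertex : ∀ i → vertexIndex (vertex i) ≡ i
  vertexIndex-vertex Fin.zero    = refl
  vertexIndex-vertex (Fin.suc i) = cong Fin.suc (index-position i)

∈childPositions-leafDepth : ∀ {t a} (p : Pos t) {q} → q ∈ childPositions p →
                            LeafDepth (subtree q) a → LeafDepth (subtree p) (suc a)
∈childPositions-leafDepth {node l r} here (here refl)         = left
∈childPositions-leafDepth {node l r} here (there (here refl)) = right
∈childPositions-leafDepth (left p) q∈ with ∈-map⁻ left q∈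
... | _ , q∈′ , refl = ∈childPositions-leafDepth p q∈′
∈childPositions-leafDepth (right p) q∈ with ∈-map⁻ right q∈
... | _ , q∈′ , refl = ∈childPositions-leafDepth p q∈′

∈childPositions-across : ∀ {t a b} (p : Pos t) {q₁ q₂} →
                         q₁ ∈ childPositions p → q₂ ∈ childPositions p → q₁ ≢ q₂ →
                         LeafDepth (subtree q₁) a → LeafDepth (subtree q₂) b →
                         LeafDistance (subtree p) (suc (suc (a + b)))
∈childPositions-across {node l r} here (here refl) (here refl) q₁≢q₂ = ⊥-elim (q₁≢q₂ refl)
∈childPositions-across {node l r} here (here refl) (there (here refl)) _ = across
∈childPositions-across {node l r} {a} {b} here (there (here refl)) (here refl) _ d₁ d₂ =
  subst (LeafDistance (node l r)) (cong (λ c → suc (suc c)) (+-comm b a)) (across d₂ d₁)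
∈childPositions-across {node l r} here (there (here refl)) (there (here refl)) q₁≢q₂ =
  ⊥-elim (q₁≢q₂ refl)
∈childPositions-across (left p) q₁∈ q₂∈ q₁≢q₂ with ∈-map⁻ left q₁∈ | ∈-map⁻ left q₂∈
... | _ , q₁∈′ , refl | _ , q₂∈′ , refl =
  ∈childPositions-across p q₁∈′ q₂∈′ (λ e → q₁≢q₂ (cong left e))
∈childPositions-across (right p) q₁∈ q₂∈ q₁≢q₂ with ∈-map⁻ right q₁∈ | ∈-map⁻ right q₂∈
... | _ , q₁∈′ , refl | _ , q₂∈′ , refl =
  ∈childPositions-across p q₁∈′ q₂∈′ (λ e → q₁≢q₂ (cong right e))

distance-in-subtree : ∀ {t c} (p : Pos t) → LeafDistance (subtree p) c → LeafDistance t c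
distance-in-subtree here      d = d
distance-in-subtree (left p)  d = left (distance-in-subtree p d)
distance-in-subtree (right p) d = right (distance-in-subtree p d)

data PlantedDistance (t : Bin) : ℕ → Set where
  trivial  : PlantedDistance t 0
  via-stem : ∀ {a} → LeafDepth t a → PlantedDistance t (suc a)
  inside   : ∀ {c} → LeafDistance t c → PlantedDistance t c

module Planted (t : Bin) where
  open TreeGraph (vertices t) (plantedTree t) public
  open RootedTreeProperties (plantedTree t)
  open Inverse (vertices t) using (to)

  data LeafVertex : Vertex t → Set where
    stem : LeafVertex nothing
    tip  : ∀ {q} → subtree q ≡ leaf → LeafVertex (just q)

  degree-just : ∀ i {p} → to i ≡ just p → degree graph i ≡ suc (arity (subtree p))
  degree-just i {p} i↦p = trans (degree-nonroot i (λ i↦nothing → just≢nothing (trans (sym i↦p) i↦nothing)))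
    (cong suc (trans (cong (length ∘ vertexChildren) i↦p)
                     (trans (length-map just (childPositions p)) (length-childPositions p))))
    where
    just≢nothing : ∀ {A : Set} {x : A} → just x ≢ nothing
    just≢nothing ()

  is13Tree : Is13Tree graph
  is13Tree = is-tree , λ i → degree-1-or-3 i refl
    where
    degree-1-or-3 : ∀ i {v} → to i ≡ v → degree graph i ≡ 1 ⊎ degree graph i ≡ 3
    degree-1-or-3 i {nothing} i↦ = inj₁ (degree-root i i↦)
    degree-1-or-3 i {just p}  i↦ with subtree p | degree-just i i↦
    ... | leaf     | d = inj₁ d
    ... | node _ _ | d = inj₂ d

  leafVertex : ∀ i → IsLeaf graph i → LeafVertex (to i)
  leafVertex i i-leaf = go refl
    where
    go : ∀ {v} → to i ≡ v → LeafVertex v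
    go {nothing} _  = stem
    go {just p}  i↦ with subtree p in p-shape | trans (sym i-leaf) (degree-just i i↦)
    ... | leaf | _ = tip p-shape

  tip-childless : ∀ {q c} → subtree q ≡ leaf → ¬ Child (just q) c
  tip-childless {c = nothing} _ (c≢nothing , _) = c≢nothing refl
  tip-childless {q} {just c} q-tip (_ , c↑q)
    with subst (c ∈_) (childPositions-tip q q-tip) (Equivalence.from ∈-childPositions c↑q)
  ... | ()

  stem-child : ∀ {c} → Child nothing c → c ≡ just here
  stem-child {nothing} (c≢nothing , _) = ⊥-elim (c≢nothing refl)
  stem-child {just c}  (_ , c↑stem)    = cong just (parentPos-root c↑stem)

  descendant-leafDepth : ∀ a {p y} → Descendant a (just p) y → LeafVertex y → LeafDepth (subtree p) a
  descendant-leafDepth zero    refl                    (tip p-tip) = subst (λ b → LeafDepth b 0) (sym p-tip) here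
  descendant-leafDepth (suc a) d                       stem        = ⊥-elim (descendant-nonroot d refl)
  descendant-leafDepth (suc a) (nothing , (c≢nothing , _) , _) _  = ⊥-elim (c≢nothing refl)
  descendant-leafDepth (suc a) {p} (just c , (_ , c↑p) , d) y-leaf =
    ∈childPositions-leafDepth p (Equivalence.from ∈-childPositions c↑p) (descendant-leafDepth a d y-leaf)

  branch : ∀ a {p y} (d : Descendant (suc a) (just p) y) → LeafVertex y →
           Σ (Pos t) λ q → firstChild d ≡ just q × q ∈ childPositions p × LeafDepth (subtree q) a
  branch a (nothing , (c≢nothing , _) , _) _ = ⊥-elim (c≢nothing refl)
  branch a (just q , (_ , q↑p) , d) y-leaf  =
    q , refl , Equivalence.from ∈-childPositions q↑p , descendant-leafDepth a d y-leaf

  stem-leafDepth : ∀ a {y} → Descendant (suc a) nothing y → LeafVertex y → LeafDepth t a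
  stem-leafDepth a (_ , child , d) y-leaf with stem-child child
  ... | refl = descendant-leafDepth a d y-leaf

  -- Only the stem is a leaf with a child, so a path that only climbs or only descends ends at the stem.
  classify : ∀ a b {top x y} (climb : Descendant a top x) (descent : Descendant b top y) →
             Forked climb descent → LeafVertex x → LeafVertex y → PlantedDistance t (a + b)
  classify zero    zero    _    _                _ _           _           = trivial
  classify zero    (suc b) refl descent          _ stem        y-leaf      = via-stem (stem-leafDepth b descent y-leaf)
  classify zero    (suc b) refl (_ , child , _)  _ (tip x-tip) _           = ⊥-elim (tip-childless x-tip child)
  classify (suc a) zero    climb refl            _ x-leaf      stem        =
    subst (PlantedDistance t) (cong suc (sym (+-identityʳ a))) (via-stem (stem-leafDepth a climb x-leaf))
  classify (suc a) zero    (_ , child , _) refl  _ _           (tip y-tip) = ⊥-elim (tip-childless y-tip child)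
  classify (suc a) (suc b) {nothing} (_ , child₁ , _) (_ , child₂ , _) forked _ _ =
    ⊥-elim (forked (trans (stem-child child₁) (sym (stem-child child₂))))
  classify (suc a) (suc b) {just p} climb descent forked x-leaf y-leaf
    with branch a climb x-leaf | branch b descent y-leaf
  ... | q₁ , first₁ , q₁∈ , depth₁ | q₂ , first₂ , q₂∈ , depth₂ =
    inside (subst (LeafDistance t) (cong suc (sym (+-suc a b)))
      (distance-in-subtree p (∈childPositions-across p q₁∈ q₂∈
        (λ q₁≡q₂ → forked (trans first₁ (trans (cong just q₁≡q₂) (sym first₂)))) depth₁ depth₂)))

  leafPath-distance : ∀ {ℓ} → LeafPathLength graph ℓ → PlantedDistance t ℓ
  leafPath-distance (u , rest , path , u-leaf , w-leaf , refl) with path-profile path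
  ... | mkProfile _ a b len climb descent forked _ =
    subst (PlantedDistance t) (trans len (length-map to rest))
      (classify a b climb descent forked (leafVertex u u-leaf)
        (subst LeafVertex (sym (lastOf-map to u rest)) (leafVertex _ w-leaf)))

-- Combs of perfect trees

height : Bin → ℕ
height leaf       = 0
height (node l r) = suc (height l ⊔ height r)

leafDepth≤height : ∀ {t a} → LeafDepth t a → a ≤ height t
leafDepth≤height here              = z≤n
leafDepth≤height (left {l} {r} d)  = s≤s (≤-trans (leafDepth≤height d) (m≤m⊔n (height l) (height r)))
leafDepth≤height (right {l} {r} d) = s≤s (≤-trans (leafDepth≤height d) (m≤n⊔m (height l) (height r)))

leafDistance≤2*height : ∀ {t c} → LeafDistance t c → c ≤ 2 * height t
leafDistance≤2*height (across {l} {r} {a} {b} dₗ dᵣ) = begin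
  suc (suc (a + b)) ≤⟨ s≤s (s≤s (+-mono-≤ (≤-trans (leafDepth≤height dₗ) (m≤m⊔n (height l) (height r)))
                                         (≤-trans (leafDepth≤height dᵣ) (m≤n⊔m (height l) (height r))))) ⟩
  suc (suc (h + h)) ≡⟨ double h ⟩
  2 * suc h         ∎
  where
  open ≤-Reasoning
  h = height l ⊔ height r
  double : ∀ x → suc (suc (x + x)) ≡ 2 * suc x
  double = solve-∀
leafDistance≤2*height (left {l} {r} d)  =
  ≤-trans (leafDistance≤2*height d) (*-monoʳ-≤ 2 (m≤n⇒m≤1+n (m≤m⊔n (height l) (height r))))
leafDistance≤2*height (right {l} {r} d) =
  ≤-trans (leafDistance≤2*height d) (*-monoʳ-≤ 2 (m≤n⇒m≤1+n (m≤n⊔m (height l) (height r))))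

perfect : ℕ → Bin
perfect zero    = leaf
perfect (suc h) = node (perfect h) (perfect h)

leaves-perfect : ∀ h → leaves (perfect h) ≡ 2 ^ h
leaves-perfect zero    = refl
leaves-perfect (suc h) =
  trans (cong₂ _+_ (leaves-perfect h) (leaves-perfect h)) (cong (2 ^ h +_) (sym (+-identityʳ (2 ^ h))))

height-perfect : ∀ h → height (perfect h) ≡ h
height-perfect zero    = refl
height-perfect (suc h) = cong suc (trans (⊔-idem (height (perfect h))) (height-perfect h))

leafDepth-perfect : ∀ h {a} → LeafDepth (perfect h) a → a ≡ h
leafDepth-perfect zero    here      = refl
leafDepth-perfect (suc h) (left d)  = cong suc (leafDepth-perfect h d)
leafDepth-perfect (suc h) (right d) = cong suc (leafDepth-perfect h d)

leafDistance-perfect : ∀ h {c} → LeafDistance (perfect h) c → c ≤ 2 * h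
leafDistance-perfect h d = subst (λ x → _ ≤ 2 * x) (height-perfect h) (leafDistance≤2*height d)

∸-half : ∀ D {j} → j ≤ 2 ^ suc D → j ∸ 2 ^ D ≤ 2 ^ D
∸-half D {j} j≤ = ≤-trans (∸-monoˡ-≤ (2 ^ D) j≤)
  (≤-reflexive (trans (m+n∸m≡n (2 ^ D) (2 ^ D + 0)) (+-identityʳ (2 ^ D))))

-- The perfect tree of depth D with j ≤ 2 ^ D of its leaves turned into cherries.
split : ℕ → ℕ → Bin
split zero    zero    = leaf
split zero    (suc _) = node leaf leaf
split (suc D) j with j ≤? 2 ^ D
... | yes _ = node (split D j) (perfect D)
... | no  _ = node (perfect (suc D)) (split D (j ∸ 2 ^ D))

leaves-split : ∀ D {j} → j ≤ 2 ^ D → leaves (split D j) ≡ 2 ^ D + j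
leaves-split zero {zero}        _         = refl
leaves-split zero {suc zero}    _         = refl
leaves-split zero {suc (suc j)} (s≤s ())
leaves-split (suc D) {j} j≤ with j ≤? 2 ^ D
... | yes j≤′ = trans (cong₂ _+_ (leaves-split D j≤′) (leaves-perfect D)) (rearrange (2 ^ D) j)
  where
  rearrange : ∀ x j → x + j + x ≡ x + (x + 0) + j
  rearrange = solve-∀
... | no j≰ = trans (cong₂ _+_ (leaves-perfect (suc D)) (leaves-split D (∸-half D j≤)))
                    (cong (2 ^ suc D +_) (m+[n∸m]≡n (≰⇒≥ j≰)))

leafDepth-split : ∀ D j {a} → LeafDepth (split D j) a → a ≡ D ⊎ a ≡ suc D
leafDepth-split zero zero          here         = inj₁ refl
leafDepth-split zero (suc _)       (left here)  = inj₂ refl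
leafDepth-split zero (suc _)       (right here) = inj₂ refl
leafDepth-split (suc D) j d with j ≤? 2 ^ D | d
... | yes _ | left d′  = Sum.map (cong suc) (cong suc) (leafDepth-split D j d′)
... | yes _ | right d′ = inj₁ (cong suc (leafDepth-perfect D d′))
... | no _  | left d′  = inj₂ (cong suc (leafDepth-perfect (suc D) d′))
... | no _  | right d′ = Sum.map (cong suc) (cong suc) (leafDepth-split D (j ∸ 2 ^ D) d′)

height-split : ∀ D j → height (split D j) ≤ suc D
height-split zero    zero    = z≤n
height-split zero    (suc _) = s≤s z≤n
height-split (suc D) j with j ≤? 2 ^ D
... | yes _ = s≤s (⊔-lub (height-split D j) (≤-trans (≤-reflexive (height-perfect D)) (n≤1+n D)))
... | no  _ = s≤s (⊔-lub (≤-reflexive (height-perfect (suc D))) (height-split D (j ∸ 2 ^ D)))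

fit : ℕ → ℕ → Bin
fit zero    k = leaf
fit (suc t) k with k ≤? 2 ^ t
... | yes _ = fit t k
... | no  _ = split t (k ∸ 2 ^ t)

leaves-fit : ∀ t {k} → 1 ≤ k → k ≤ 2 ^ t → leaves (fit t k) ≡ k
leaves-fit zero    {suc zero}    _ _        = refl
leaves-fit zero    {suc (suc _)} _ (s≤s ())
leaves-fit (suc t) {k} 1≤k k≤ with k ≤? 2 ^ t
... | yes k≤′ = leaves-fit t 1≤k k≤′
... | no  k≰  = trans (leaves-split t (∸-half t k≤)) (m+[n∸m]≡n (≰⇒≥ k≰))

leafDepth-fit : ∀ t k → ∃ λ D → ∀ {a} → LeafDepth (fit t k) a → a ≡ D ⊎ a ≡ suc D
leafDepth-fit zero    k = 0 , λ { here → inj₁ refl }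
leafDepth-fit (suc t) k with k ≤? 2 ^ t
... | yes _ = leafDepth-fit t k
... | no  _ = t , leafDepth-split t (k ∸ 2 ^ t)

height-fit : ∀ t k → height (fit t k) ≤ t
height-fit zero    k = z≤n
height-fit (suc t) k with k ≤? 2 ^ t
... | yes _ = ≤-trans (height-fit t k) (n≤1+n t)
... | no  _ = height-split t (k ∸ 2 ^ t)

comb : (ℕ → ℕ) → ℕ → Bin → Bin
comb h zero    e = e
comb h (suc m) e = node (perfect (h 0)) (comb (h ∘ suc) m e)

data CombDepth (h : ℕ → ℕ) (m : ℕ) (e : Bin) (a : ℕ) : Set where
  pendant : ∀ i → a ≡ i + suc (h i) → CombDepth h m e a
  end     : ∀ {a′} → LeafDepth e a′ → a ≡ m + a′ → CombDepth h m e a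

leafDepth-comb : ∀ h m {e a} → LeafDepth (comb h m e) a → CombDepth h m e a
leafDepth-comb h zero    d         = end d refl
leafDepth-comb h (suc m) (left d)  = pendant 0 (cong suc (leafDepth-perfect (h 0) d))
leafDepth-comb h (suc m) (right d) with leafDepth-comb (h ∘ suc) m d
... | pendant i eq = pendant (suc i) (cong suc eq)
... | end d′ eq    = end d′ (cong suc eq)

data CombDistance (h : ℕ → ℕ) (m : ℕ) (e : Bin) (c : ℕ) : Set where
  within-pendant   : ∀ i → c ≤ 2 * h i → CombDistance h m e c
  between-pendants : ∀ i j → i ≤ j → c + i ≡ 2 + h i + (j + h j) → CombDistance h m e c
  pendant-to-end   : ∀ i {a′} → i ≤ m → LeafDepth e a′ → c + i ≡ suc (h i + (m + a′)) → CombDistance h m e c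
  within-end       : LeafDistance e c → CombDistance h m e c

leafDistance-comb : ∀ h m {e c} → LeafDistance (comb h m e) c → CombDistance h m e c
leafDistance-comb h zero    d = within-end d
leafDistance-comb h (suc m) (across {a = a} {b} dₗ dᵣ)
  with leafDepth-perfect (h 0) dₗ | leafDepth-comb (h ∘ suc) m dᵣ
... | refl | pendant i refl = between-pendants 0 (suc i) z≤n (rearrange (h 0) i (h (suc i)))
  where
  rearrange : ∀ x i y → suc (suc (x + (i + suc y))) + 0 ≡ 2 + x + (suc i + y)
  rearrange = solve-∀
... | refl | end dₑ refl   = pendant-to-end 0 z≤n dₑ (rearrange (h 0) m _)
  where
  rearrange : ∀ x m a → suc (suc (x + (m + a))) + 0 ≡ suc (x + (suc m + a))
  rearrange = solve-∀
leafDistance-comb h (suc m) (left d) = within-pendant 0 (leafDistance-perfect (h 0) d)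
leafDistance-comb h (suc m) {c = c} (right d) with leafDistance-comb (h ∘ suc) m d
... | within-pendant i le = within-pendant (suc i) le
... | between-pendants i j i≤j eq =
  between-pendants (suc i) (suc j) (s≤s i≤j) (trans (+-suc c i) (trans (cong suc eq) (rearrange (h (suc i)) j _)))
  where
  rearrange : ∀ x j y → suc (2 + x + (j + y)) ≡ 2 + x + (suc j + y)
  rearrange = solve-∀
... | pendant-to-end i i≤m dₑ eq =
  pendant-to-end (suc i) (s≤s i≤m) dₑ (trans (+-suc c i) (trans (cong suc eq) (rearrange (h (suc i)) m _)))
  where
  rearrange : ∀ x m a → suc (suc (x + (m + a))) ≡ suc (x + (suc m + a))
  rearrange = solve-∀
... | within-end dₑ = within-end dₑ

comb-with-leaves : ∀ h {k} → 1 ≤ k → ∃[ m ] ∃[ k′ ] leaves (comb h m (fit (h m) k′)) ≡ k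
comb-with-leaves h {k} 1≤k = go k h ≤-refl 1≤k
  where
  go : ∀ fuel h {k} → k ≤ fuel → 1 ≤ k → ∃[ m ] ∃[ k′ ] leaves (comb h m (fit (h m) k′)) ≡ k
  go zero       h k≤0 1≤k with () ← ≤-trans 1≤k k≤0
  go (suc fuel) h {k} k≤ 1≤k with k ≤? 2 ^ h 0
  ... | yes k≤2^h₀ = 0 , k , leaves-fit (h 0) 1≤k k≤2^h₀
  ... | no  k≰2^h₀ with go fuel (h ∘ suc) (≤-trans (∸-monoʳ-≤ k (m^n>0 2 (h 0))) (∸-monoˡ-≤ 1 k≤))
                          (m<n⇒0<n∸m (≰⇒> k≰2^h₀))
  ...   | m , k′ , leaves≡ =
    suc m , k′ , trans (cong₂ _+_ (leaves-perfect (h 0)) leaves≡) (m+[n∸m]≡n (≰⇒≥ k≰2^h₀))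

-- Numerals with restricted digits

length-cartesianProductWith : ∀ {A B C : Set} (f : A → B → C) xs ys →
  length (cartesianProductWith f xs ys) ≡ length xs * length ys
length-cartesianProductWith f []       ys = refl
length-cartesianProductWith f (x ∷ xs) ys = trans (length-++ (map (f x) ys))
  (cong₂ _+_ (length-map (f x) ys) (length-cartesianProductWith f xs ys))

module BaseNumerals (b : ℕ) .{{_ : NonZero b}} where

  numerals : List ℕ → ℕ → List ℕ
  numerals ds zero    = 0 ∷ []
  numerals ds (suc k) = cartesianProductWith (λ d x → d + b * x) ds (numerals ds k)

  length-numerals : ∀ ds k → length (numerals ds k) ≡ length ds ^ k
  length-numerals ds zero    = refl
  length-numerals ds (suc k) = trans (length-cartesianProductWith _ ds (numerals ds k))
                                     (cong (length ds *_) (length-numerals ds k))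

  numerals-+ : ∀ {ds es fs} → (∀ {d e} → d ∈ ds → e ∈ es → d + e ∈ fs) →
               ∀ k {x y} → x ∈ numerals ds k → y ∈ numerals es k → x + y ∈ numerals fs k
  numerals-+ sums zero    (here refl) (here refl) = here refl
  numerals-+ {ds} {es} {fs} sums (suc k) x∈ y∈
    with ∈-cartesianProductWith⁻ _ ds (numerals ds k) x∈ | ∈-cartesianProductWith⁻ _ es (numerals es k) y∈
  ... | d , x , d∈ , x∈′ , refl | e , y , e∈ , y∈′ , refl =
    subst (_∈ numerals fs (suc k)) (regroup b d x e y)
      (∈-cartesianProductWith⁺ (λ d x → d + b * x) (sums d∈ e∈) (numerals-+ sums k x∈′ y∈′))
    where
    regroup : ∀ b d x e y → d + e + b * (x + y) ≡ d + b * x + (e + b * y)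
    regroup = solve-∀

  digitwise : (ℕ → ℕ) → ℕ → ℕ → ℕ
  digitwise f zero    z = 0
  digitwise f (suc k) z = f (z % b) + b * digitwise f k (z / b)

  digitwise-∈ : ∀ {f ds} → (∀ {r} → r < b → f r ∈ ds) → ∀ k z → digitwise f k z ∈ numerals ds k
  digitwise-∈ f∈ zero    z = here refl
  digitwise-∈ f∈ (suc k) z = ∈-cartesianProductWith⁺ _ (f∈ (m%n<n z b)) (digitwise-∈ f∈ k (z / b))

  digitwise-+ : ∀ f g k z → digitwise (λ r → f r + g r) k z ≡ digitwise f k z + digitwise g k z
  digitwise-+ f g zero    z = refl
  digitwise-+ f g (suc k) z = trans (cong (λ x → f (z % b) + g (z % b) + b * x) (digitwise-+ f g k (z / b)))
                                    (regroup b (f (z % b)) (g (z % b)) (digitwise f k (z / b)) (digitwise g k (z / b)))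
    where
    regroup : ∀ b p q x y → p + q + b * (x + y) ≡ p + b * x + (q + b * y)
    regroup = solve-∀

  digitwise-id : ∀ k {z} → z < b ^ k → digitwise (λ r → r) k z ≡ z
  digitwise-id zero    {zero}  _         = refl
  digitwise-id zero    {suc z} (s≤s ())
  digitwise-id (suc k) {z}    z< = begin
    z % b + b * digitwise (λ r → r) k (z / b) ≡⟨ cong (λ x → z % b + b * x) (digitwise-id k z/b<) ⟩
    z % b + b * (z / b)                        ≡⟨ cong (z % b +_) (*-comm b (z / b)) ⟩
    z % b + z / b * b                          ≡⟨ sym (m≡m%n+[m/n]*n z b) ⟩
    z                                          ∎
    where
    open ≡-Reasoning
    z/b< : z / b < b ^ k
    z/b< = m<n*o⇒m/o<n (subst (z <_) (*-comm b (b ^ k)) z<)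

  digitwise-bound : ∀ {f} → (∀ {r} → r < b → 2 * f r + 1 ≤ b) → ∀ k z → 2 * digitwise f k z + 1 ≤ b ^ k
  digitwise-bound bounded zero    z = ≤-refl
  digitwise-bound {f} bounded (suc k) z = begin
    2 * (f r + b * x) + 1     ≡⟨ regroup b (f r) x ⟩
    (2 * f r + 1) + b * (2 * x) ≤⟨ +-monoˡ-≤ (b * (2 * x)) (bounded (m%n<n z b)) ⟩
    b + b * (2 * x)           ≡⟨ sym (*-suc b (2 * x)) ⟩
    b * suc (2 * x)           ≡⟨ cong (b *_) (+-comm 1 (2 * x)) ⟩
    b * (2 * x + 1)           ≤⟨ *-monoʳ-≤ b (digitwise-bound bounded k (z / b)) ⟩
    b * b ^ k                 ∎
    where
    open ≤-Reasoning
    r = z % b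
    x = digitwise f k (z / b)
    regroup : ∀ b p x → 2 * (p + b * x) + 1 ≡ (2 * p + 1) + b * (2 * x)
    regroup = solve-∀

open BaseNumerals 7

lowDigit : ℕ → ℕ
lowDigit 0 = 3
lowDigit 1 = 3
lowDigit 2 = 1
lowDigit 5 = 1
lowDigit _ = 0

lowDigits highDigits sumDigits : List ℕ
lowDigits  = 0 ∷ 1 ∷ 3 ∷ []
highDigits = 3 ∷ 4 ∷ 6 ∷ []
sumDigits  = 3 ∷ 4 ∷ 5 ∷ 6 ∷ 7 ∷ 9 ∷ []

residue-table : All (λ r → lowDigit r ∈ lowDigits × lowDigit r + r ∈ highDigits × 2 * lowDigit r + 1 ≤ 7) (upTo 7)
residue-table = from-yes (all? (λ r → lowDigit r ∈? lowDigits ×-dec lowDigit r + r ∈? highDigits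
                                       ×-dec 2 * lowDigit r + 1 ≤? 7) (upTo 7))
  where open import Data.List.Membership.DecPropositional Data.Nat._≟_ using (_∈?_)

sum-table : All (λ d → All (λ e → d + e ∈ sumDigits) highDigits) lowDigits
sum-table = from-yes (all? (λ d → all? (λ e → d + e ∈? sumDigits) highDigits) lowDigits)
  where open import Data.List.Membership.DecPropositional Data.Nat._≟_ using (_∈?_)

lower : ℕ → ℕ → ℕ
lower = digitwise lowDigit

lower-∈ : ∀ k z → lower k z ∈ numerals lowDigits k
lower-∈ = digitwise-∈ (λ r<7 → proj₁ (All.lookup residue-table (∈-upTo⁺ r<7)))

lower+id-∈ : ∀ k {z} → z < 7 ^ k → lower k z + z ∈ numerals highDigits k
lower+id-∈ k {z} z< = subst (_∈ numerals highDigits k)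
  (trans (digitwise-+ lowDigit (λ r → r) k z) (cong (lower k z +_) (digitwise-id k z<)))
  (digitwise-∈ (λ r<7 → proj₁ (proj₂ (All.lookup residue-table (∈-upTo⁺ r<7)))) k z)

lower+lower+id-∈ : ∀ k z {z′} → z′ < 7 ^ k → lower k z + (lower k z′ + z′) ∈ numerals sumDigits k
lower+lower+id-∈ k z z′< =
  numerals-+ (λ d∈ e∈ → All.lookup (All.lookup sum-table d∈) e∈) k (lower-∈ k z) (lower+id-∈ k z′<)

lower-bound : ∀ k z → 2 * lower k z + 1 ≤ 7 ^ k
lower-bound = digitwise-bound (λ r<7 → proj₂ (proj₂ (All.lookup residue-table (∈-upTo⁺ r<7))))

-- Counting leaf-to-leaf distances

^-distribʳ-* : ∀ m n o → (m * n) ^ o ≡ m ^ o * n ^ o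
^-distribʳ-* m n zero    = refl
^-distribʳ-* m n (suc o) = trans (cong (m * n *_) (^-distribʳ-* m n o)) (regroup m n (m ^ o) (n ^ o))
  where
  regroup : ∀ m n x y → m * n * (x * y) ≡ m * x * (n * y)
  regroup = solve-∀

module Scale (d : ℕ) where

  s : ℕ
  s = 7 ^ d

  instance
    s-nonZero : NonZero s
    s-nonZero = m^n≢0 7 d

  ρ κ : ℕ → ℕ
  ρ p = p % s
  κ p = p / s

  low : ℕ → ℕ
  low p = lower (suc d) (2 * ρ p)

  pendantDepth : ℕ → ℕ
  pendantDepth p = low p + ρ p

  decompose : ∀ p → p ≡ ρ p + κ p * s
  decompose p = m≡m%n+[m/n]*n p s

  2ρ<7s : ∀ p → 2 * ρ p < 7 ^ suc d
  2ρ<7s p = <-≤-trans (*-monoʳ-< 2 (m%n<n p s)) (*-monoˡ-≤ s {2} {7} (s≤s (s≤s z≤n)))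

  2*pendantDepth≤9s : ∀ p → 2 * pendantDepth p ≤ 9 * s
  2*pendantDepth≤9s p = begin
    2 * (low p + ρ p)       ≡⟨ *-distribˡ-+ 2 (low p) (ρ p) ⟩
    2 * low p + 2 * ρ p     ≤⟨ +-mono-≤ (≤-trans (m≤m+n (2 * low p) 1) (lower-bound (suc d) (2 * ρ p)))
                                         (*-monoʳ-≤ 2 (<⇒≤ (m%n<n p s))) ⟩
    7 * s + 2 * s           ≡⟨ sym (*-distribʳ-+ s 7 2) ⟩
    9 * s                   ∎
    where open ≤-Reasoning

  p+pendantDepth : ∀ p → p + pendantDepth p ≡ (low p + 2 * ρ p) + κ p * s
  p+pendantDepth p = trans (cong (_+ pendantDepth p) (decompose p)) (regroup (ρ p) (κ p * s) (low p))
    where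
    regroup : ∀ r K L → r + K + (L + r) ≡ L + 2 * r + K
    regroup = solve-∀

  drop-residue : ∀ {ℓ i} X Y → ℓ + i ≡ X + ρ i + Y → ℓ + κ i * s ≡ X + Y
  drop-residue {ℓ} {i} X Y eq = +-cancelʳ-≡ (ρ i) _ _ (begin
    ℓ + κ i * s + ρ i      ≡⟨ +-assoc ℓ (κ i * s) (ρ i) ⟩
    ℓ + (κ i * s + ρ i)    ≡⟨ cong (ℓ +_) (trans (+-comm (κ i * s) (ρ i)) (sym (decompose i))) ⟩
    ℓ + i                  ≡⟨ eq ⟩
    X + ρ i + Y            ≡⟨ regroup X (ρ i) Y ⟩
    X + Y + ρ i            ∎)
    where
    open ≡-Reasoning
    regroup : ∀ X r Y → X + r + Y ≡ X + Y + r
    regroup = solve-∀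

  grid : ℕ → List ℕ → List ℕ
  grid N xs = cartesianProductWith (λ x Δ → x + Δ * s) xs (upTo (suc (N / s)))

  length-grid : ∀ N xs → length (grid N xs) ≡ length xs * suc (N / s)
  length-grid N xs = trans (length-cartesianProductWith _ xs (upTo (suc (N / s))))
                           (cong (length xs *_) (length-upTo (suc (N / s))))

  ∈-grid : ∀ {N ℓ X xs Δ₁ Δ₂} → X ∈ xs → Δ₁ ≤ Δ₂ → ℓ + Δ₁ * s ≡ X + Δ₂ * s → ℓ ≤ N → ℓ ∈ grid N xs
  ∈-grid {N} {ℓ} {X} {xs} {Δ₁} {Δ₂} X∈ Δ₁≤Δ₂ eq ℓ≤N =
    subst (_∈ grid N xs) (sym ℓ≡) (∈-cartesianProductWith⁺ _ X∈ (∈-upTo⁺ (s≤s Δ≤N/s)))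
    where
    Δ = Δ₂ ∸ Δ₁
    ℓ≡ : ℓ ≡ X + Δ * s
    ℓ≡ = +-cancelʳ-≡ (Δ₁ * s) ℓ (X + Δ * s) (trans eq (trans
           (cong (λ y → X + y * s) (sym (m∸n+n≡m Δ₁≤Δ₂))) (regroup X Δ Δ₁ s)))
      where
      regroup : ∀ X Δ Δ₁ s → X + (Δ + Δ₁) * s ≡ X + Δ * s + Δ₁ * s
      regroup = solve-∀
    Δ≤N/s : Δ ≤ N / s
    Δ≤N/s = subst (_≤ N / s) (m*n/n≡m Δ s)
              (/-monoˡ-≤ s (≤-trans (m≤n+m (Δ * s) X) (≤-trans (≤-reflexive (sym ℓ≡)) ℓ≤N)))

  6^[1+d]*[1+N/s]≤56s : ∀ {N} → N < 8 ^ suc d → 6 ^ suc d * suc (N / s) ≤ 56 * s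
  6^[1+d]*[1+N/s]≤56s {N} N< = begin
    6 ^ suc d * suc (N / s)       ≡⟨ *-suc (6 ^ suc d) (N / s) ⟩
    6 ^ suc d + 6 ^ suc d * (N / s) ≤⟨ +-mono-≤ (^-monoˡ-≤ (suc d) {6} {7} 6≤7) scaled ⟩
    7 * s + 49 * s                ≡⟨ sym (*-distribʳ-+ s 7 49) ⟩
    56 * s                        ∎
    where
    open ≤-Reasoning
    6≤7 : 6 ≤ 7
    6≤7 = n≤1+n 6
    scaled : 6 ^ suc d * (N / s) ≤ 49 * s
    scaled = *-cancelʳ-≤ (6 ^ suc d * (N / s)) (49 * s) s (begin
      6 ^ suc d * (N / s) * s       ≡⟨ *-assoc (6 ^ suc d) (N / s) s ⟩
      6 ^ suc d * (N / s * s)       ≤⟨ *-monoʳ-≤ (6 ^ suc d) (m/n*n≤m N s) ⟩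
      6 ^ suc d * N                 ≤⟨ *-monoʳ-≤ (6 ^ suc d) (<⇒≤ N<) ⟩
      6 ^ suc d * 8 ^ suc d         ≡⟨ sym (^-distribʳ-* 6 8 (suc d)) ⟩
      48 ^ suc d                    ≤⟨ ^-monoˡ-≤ (suc d) (n≤1+n 48) ⟩
      49 * (7 * 7) ^ d              ≡⟨ cong (49 *_) (^-distribʳ-* 7 7 d) ⟩
      49 * (s * s)                  ≡⟨ sym (*-assoc 49 s s) ⟩
      49 * s * s                    ∎)

module LengthSet (d N m k′ : ℕ) where
  open Scale d

  tree : Bin
  tree = comb pendantDepth m (fit (pendantDepth m) k′)

  D : ℕ
  D = proj₁ (leafDepth-fit (pendantDepth m) k′)

  lows highs sums : List ℕ
  lows  = numerals lowDigits (suc d)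
  highs = numerals highDigits (suc d)
  sums  = numerals sumDigits (suc d)

  -- Distances from the stem, between two pendant trees, and from a pendant tree to the
  -- closing tree, whose leaves have depth D or suc D.
  offsets : List ℕ
  offsets = map (2 +_) highs ++ map (2 +_) sums
         ++ map (_+ suc (ρ m + D)) lows ++ map (_+ suc (ρ m + suc D)) lows

  lengths : List ℕ
  lengths = upTo (suc (9 * s)) ++ suc (m + D) ∷ suc (m + suc D) ∷ grid N offsets

  small : ∀ {ℓ} → ℓ ≤ 9 * s → ℓ ∈ lengths
  small ℓ≤ = ∈-++⁺ˡ (∈-upTo⁺ (s≤s ℓ≤))

  gridded : ∀ {ℓ X Δ₁ Δ₂} → X ∈ offsets → Δ₁ ≤ Δ₂ → ℓ + Δ₁ * s ≡ X + Δ₂ * s → ℓ ≤ N → ℓ ∈ lengths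
  gridded X∈ Δ₁≤Δ₂ eq ℓ≤N = ∈-++⁺ʳ (upTo (suc (9 * s))) (there (there (∈-grid X∈ Δ₁≤Δ₂ eq ℓ≤N)))

  high-offset : ∀ {x} → x ∈ highs → 2 + x ∈ offsets
  high-offset x∈ = ∈-++⁺ˡ (∈-map⁺ (2 +_) x∈)

  sum-offset : ∀ {x} → x ∈ sums → 2 + x ∈ offsets
  sum-offset x∈ = ∈-++⁺ʳ (map (2 +_) highs) (∈-++⁺ˡ (∈-map⁺ (2 +_) x∈))

  end-offset : ∀ {x a′} → a′ ≡ D ⊎ a′ ≡ suc D → x ∈ lows → x + suc (ρ m + a′) ∈ offsets
  end-offset (inj₁ refl) x∈ =
    ∈-++⁺ʳ (map (2 +_) highs) (∈-++⁺ʳ (map (2 +_) sums) (∈-++⁺ˡ (∈-map⁺ (_+ suc (ρ m + D)) x∈)))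
  end-offset (inj₂ refl) x∈ =
    ∈-++⁺ʳ (map (2 +_) highs) (∈-++⁺ʳ (map (2 +_) sums)
      (∈-++⁺ʳ (map (_+ suc (ρ m + D)) lows) (∈-map⁺ (_+ suc (ρ m + suc D)) x∈)))

  ∈-lengths : ∀ {ℓ} → ℓ ≤ N → PlantedDistance tree ℓ → ℓ ∈ lengths
  ∈-lengths ℓ≤N trivial = small z≤n
  ∈-lengths ℓ≤N (via-stem dep) with leafDepth-comb pendantDepth m dep
  ... | pendant i refl = gridded {Δ₂ = κ i} (high-offset (lower+id-∈ (suc d) (2ρ<7s i))) z≤n
          (trans (+-identityʳ _) (trans (cong suc (+-suc i (pendantDepth i))) (cong (2 +_) (p+pendantDepth i))))
          ℓ≤N
  ... | end dep′ refl with proj₂ (leafDepth-fit (pendantDepth m) k′) dep′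
  ...   | inj₁ refl = ∈-++⁺ʳ (upTo (suc (9 * s))) (here refl)
  ...   | inj₂ refl = ∈-++⁺ʳ (upTo (suc (9 * s))) (there (here refl))
  ∈-lengths ℓ≤N (inside dist) with leafDistance-comb pendantDepth m dist
  ... | within-pendant i ℓ≤ = small (≤-trans ℓ≤ (2*pendantDepth≤9s i))
  ... | between-pendants i j i≤j eq =
    gridded (sum-offset (lower+lower+id-∈ (suc d) (2 * ρ i) (2ρ<7s j))) (/-monoˡ-≤ s i≤j)
      (trans (drop-residue (2 + low i) (j + pendantDepth j) eq)
             (trans (cong (2 + low i +_) (p+pendantDepth j)) (regroup (low i) _ _))) ℓ≤N
    where
    regroup : ∀ L P K → 2 + L + (P + K) ≡ 2 + (L + P) + K
    regroup = solve-∀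
  ... | pendant-to-end i {a′} i≤m dep′ eq =
    gridded {Δ₂ = κ m} (end-offset (proj₂ (leafDepth-fit (pendantDepth m) k′) dep′) (lower-∈ (suc d) (2 * ρ i)))
      (/-monoˡ-≤ s i≤m)
      (trans (drop-residue (suc (low i)) (m + a′) eq)
             (trans (cong (λ x → suc (low i) + (x + a′)) (decompose m)) (regroup (low i) (ρ m) (κ m * s) a′)))
      ℓ≤N
    where
    regroup : ∀ L r K a → suc L + (r + K + a) ≡ L + suc (r + a) + K
    regroup = solve-∀
  ... | within-end dist′ =
    small (≤-trans (leafDistance≤2*height dist′)
                   (≤-trans (*-monoʳ-≤ 2 (height-fit (pendantDepth m) k′)) (2*pendantDepth≤9s m)))

  length-offsets : length offsets ≡ 3 ^ suc d + (6 ^ suc d + (3 ^ suc d + 3 ^ suc d))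
  length-offsets =
    trans (length-++ (map (2 +_) highs))
      (cong₂ _+_ (trans (length-map (2 +_) highs) (length-numerals highDigits (suc d)))
      (trans (length-++ (map (2 +_) sums))
        (cong₂ _+_ (trans (length-map (2 +_) sums) (length-numerals sumDigits (suc d)))
        (trans (length-++ (map (_+ suc (ρ m + D)) lows))
          (cong₂ _+_ (trans (length-map _ lows) (length-numerals lowDigits (suc d)))
                     (trans (length-map _ lows) (length-numerals lowDigits (suc d))))))))

  length-lengths : N < 8 ^ suc d → length lengths ≤ 236 * s
  length-lengths N< = begin
    length lengths                         ≡⟨ length-++ (upTo (suc (9 * s))) ⟩
    length (upTo (suc (9 * s))) + (2 + length (grid N offsets))
      ≡⟨ cong₂ (λ x y → x + (2 + y)) (length-upTo (suc (9 * s))) (length-grid N offsets) ⟩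
    suc (9 * s) + (2 + length offsets * M) ≤⟨ +-monoʳ-≤ (suc (9 * s)) (+-monoʳ-≤ 2 grid-bound) ⟩
    suc (9 * s) + (2 + 224 * s)            ≡⟨ regroup s ⟩
    3 + 233 * s                            ≤⟨ +-monoˡ-≤ (233 * s) (*-monoʳ-≤ 3 (m^n>0 7 d)) ⟩
    3 * s + 233 * s                        ≡⟨ sym (*-distribʳ-+ s 3 233) ⟩
    236 * s                                ∎
    where
    open ≤-Reasoning
    M = suc (N / s)
    x₃ = 3 ^ suc d
    x₆ = 6 ^ suc d
    regroup : ∀ s → suc (9 * s) + (2 + 224 * s) ≡ 3 + 233 * s
    regroup = solve-∀
    spread : ∀ x → x + (x + (x + x)) ≡ 4 * x
    spread = solve-∀
    x₃≤x₆ : x₃ ≤ x₆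
    x₃≤x₆ = ^-monoˡ-≤ (suc d) (s≤s (s≤s (s≤s z≤n)))
    grid-bound : length offsets * M ≤ 224 * s
    grid-bound = begin
      length offsets * M               ≡⟨ cong (_* M) length-offsets ⟩
      (x₃ + (x₆ + (x₃ + x₃))) * M      ≤⟨ *-monoˡ-≤ M (+-mono-≤ x₃≤x₆ (+-monoʳ-≤ x₆ (+-mono-≤ x₃≤x₆ x₃≤x₆))) ⟩
      (x₆ + (x₆ + (x₆ + x₆))) * M      ≡⟨ cong (_* M) (spread x₆) ⟩
      4 * x₆ * M                       ≡⟨ *-assoc 4 x₆ M ⟩
      4 * (x₆ * M)                     ≤⟨ *-monoʳ-≤ 4 (6^[1+d]*[1+N/s]≤56s N<) ⟩
      4 * (56 * s)                     ≡⟨ sym (*-assoc 4 56 s) ⟩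
      224 * s                          ∎

power-bracket : ∀ b → 1 < b → ∀ N → 1 ≤ N → ∃[ d ] (b ^ d ≤ N × N < b ^ suc d)
power-bracket b 1<b (suc zero)    _ = 0 , ≤-refl , subst (1 <_) (sym (*-identityʳ b)) 1<b
power-bracket b 1<b (suc (suc N)) _ with power-bracket b 1<b (suc N) (s≤s z≤n)
... | d , lower , upper with m≤n⇒m<n∨m≡n upper
...   | inj₁ upper′ = d , m≤n⇒m≤1+n lower , upper′
...   | inj₂ N≡b^d  =
  suc d , ≤-reflexive (sym N≡b^d) , subst (_< b ^ suc (suc d)) (sym N≡b^d) (^-monoʳ-< b 1<b (n<1+n (suc d)))

7^16≤8^15 : 7 ^ 16 ≤ 8 ^ 15
7^16≤8^15 = ≤ᵇ⇒≤ (7 ^ 16) (8 ^ 15) tt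

-- L, K and d are explicit: solving for them through L ^ 16 or K * 7 ^ d would unfold the products.
count-bound : ∀ L K d {N} → L ≤ K * 7 ^ d → 8 ^ d ≤ N → L ^ 16 ≤ K ^ 16 * N ^ 15
count-bound L K d {N} L≤ 8^d≤N = begin
  L ^ 16                   ≤⟨ ^-monoˡ-≤ 16 L≤ ⟩
  (K * 7 ^ d) ^ 16         ≡⟨ ^-distribʳ-* K (7 ^ d) 16 ⟩
  K ^ 16 * (7 ^ d) ^ 16    ≤⟨ *-monoʳ-≤ (K ^ 16) (begin
      (7 ^ d) ^ 16   ≡⟨ trans (^-*-assoc 7 d 16) (trans (cong (7 ^_) (*-comm d 16)) (sym (^-*-assoc 7 16 d))) ⟩
      (7 ^ 16) ^ d   ≤⟨ ^-monoˡ-≤ d 7^16≤8^15 ⟩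
      (8 ^ 15) ^ d   ≡⟨ trans (^-*-assoc 8 15 d) (trans (cong (8 ^_) (*-comm 15 d)) (sym (^-*-assoc 8 d 15))) ⟩
      (8 ^ d) ^ 15   ≤⟨ ^-monoˡ-≤ 15 8^d≤N ⟩
      N ^ 15         ∎) ⟩
  K ^ 16 * N ^ 15          ∎
  where open ≤-Reasoning

FewLeafPathLengths : ℕ → ℕ → Set
FewLeafPathLengths N n = ∃[ G ] (Is13Tree {n} G ×
  ∃[ S ] ((∀ ℓ → ℓ ≤ N → LeafPathLength G ℓ → ℓ ∈ S) × length S ^ 16 ≤ 236 ^ 16 * N ^ 15))

planted-comb-sparse : ∀ N d m k′ → 8 ^ d ≤ N → N < 8 ^ suc d →
                      FewLeafPathLengths N (suc (size (LengthSet.tree d N m k′)))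
planted-comb-sparse N d m k′ 8^d≤N N<8^[1+d] =
  graph , is13Tree , lengths , member , count-bound (length lengths) 236 d (length-lengths N<8^[1+d]) 8^d≤N
  where
  open LengthSet d N m k′
  open Planted tree
  member : ∀ ℓ → ℓ ≤ N → LeafPathLength graph ℓ → ℓ ∈ lengths
  member ℓ ℓ≤N path = ∈-lengths ℓ≤N (leafPath-distance path)

-- No with-abstraction here: it would normalise the goal, including 236 ^ 16 * N ^ 15.
few-leafPathLengths : ∀ N k → 1 ≤ N → N ≤ k * 2 → FewLeafPathLengths N (k * 2)
few-leafPathLengths N zero    1≤N N≤0 = ⊥-elim (1+n≰n (≤-trans 1≤N N≤0))
few-leafPathLengths N (suc k) 1≤N _ =
  let d , 8^d≤N , N<8^[1+d]    = power-bracket 8 (s≤s (s≤s z≤n)) N 1≤N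
      m , k′ , leaves≡         = comb-with-leaves (Scale.pendantDepth d) {suc k} (s≤s z≤n)
  in subst (FewLeafPathLengths N) (trans (1+size≡leaves*2 _) (cong (_* 2) leaves≡))
       (planted-comb-sparse N d m k′ 8^d≤N N<8^[1+d])

theorem1p6 : ∃[ p ] ∃[ q ] ∃[ K ] (0 < p × p < q × 0 < K ×
    (∀ (N n : ℕ) → 1 ≤ N → 2 ∣ n → N ≤ n →
    ∃[ G ] (Is13Tree {n} G ×
    ∃[ S ] ((∀ ℓ → ℓ ≤ N → LeafPathLength G ℓ → ℓ ∈ S) ×
    length S ^ q ≤ K ^ q * N ^ p))))
theorem1p6 = 15 , 16 , 236 , s≤s z≤n , ≤-refl , s≤s z≤n ,
  λ { N n 1≤N (divides k refl) N≤n → few-leafPathLengths N k 1≤N N≤n }
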